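{- Let $\mathbb{C}$ be a small coconfluent category and $P,Q$ atomic sheaves on $\mathbb{C}$. Let $x,x'\in P(X)$ with $(x,x')\in\sim_P(X)$. Then for every $y\in Q(X)$ there exist a morphism $p\colon Z\to X$ and an element $y'\in Q(Z)$ such that $((x\cdot p, y\cdot p),(x'\cdot p, y'))\in\sim_{P\times Q}(Z)$.
   Context: Presheaf notation $x\cdot f := P(f)(x)$; $P\times Q$ is the pointwise product sheaf. Coconfluent: every cospan $X\to Z\leftarrow Y$ has a span $X\xleftarrow{u}W\xrightarrow{v}Y$ making the square commute. Atomic sheaf: for every $c\colon Y\to X$, every $y\in P(Y)$ with $y\cdot d=y\cdot e$ whenever $c\circ d=c\circ e$ equals $x\cdot c$ for a unique $x\in P(X)$. For an atomic sheaf $R$, $\sim_R(X) = \{(r,r')\in R(X)^2\mid \exists Z\,\exists u,u'\colon Z\to X.\ r\cdot u = r'\cdot u'\}$. -}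

module Defs where

open import Data.Product using (Σ; Σ-syntax; ∃; _×_; _,_; proj₁; proj₂)
open import Relation.Binary.PropositionalEquality using (_≡_; refl; cong₂)

record Category : Set₁ where
  infixr 9 _∘_
  field
    Obj   : Set
    Hom   : Obj → Obj → Set
    id    : ∀ {X} → Hom X X
    _∘_   : ∀ {X Y Z} → Hom Y Z → Hom X Y → Hom X Z
    idˡ   : ∀ {X Y} (f : Hom X Y) → id ∘ f ≡ f
    idʳ   : ∀ {X Y} (f : Hom X Y) → f ∘ id ≡ f
    assoc : ∀ {W X Y Z} (h : Hom Y Z) (g : Hom X Y) (f : Hom W X) →
            (h ∘ g) ∘ f ≡ h ∘ (g ∘ f)

module _ (C : Category) where
  open Category C

  Coconfluent : Set
  Coconfluent = ∀ {X Y Z} (f : Hom X Z) (g : Hom Y Z) →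
    Σ[ W ∈ Obj ] Σ[ u ∈ Hom W X ] Σ[ v ∈ Hom W Y ] (f ∘ u ≡ g ∘ v)

  -- A presheaf (Set-valued contravariant functor), written with the
  -- right action notation x · f := P(f)(x).
  record Presheaf : Set₁ where
    infixl 8 _·_
    field
      F₀   : Obj → Set
      _·_  : ∀ {X Y} → F₀ X → Hom Y X → F₀ Y
      ·-id : ∀ {X} (x : F₀ X) → x · id ≡ x
      ·-∘  : ∀ {X Y Z} (x : F₀ X) (f : Hom Y X) (g : Hom Z Y) →
             x · (f ∘ g) ≡ (x · f) · g

  IsAtomic : Presheaf → Set
  IsAtomic P = ∀ {X Y} (c : Hom Y X) (y : F₀ Y) →
      (∀ {W} (d e : Hom W Y) → c ∘ d ≡ c ∘ e → y · d ≡ y · e) →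
      Σ[ x ∈ F₀ X ] ((x · c ≡ y) × (∀ (x' : F₀ X) → x' · c ≡ y → x' ≡ x))
    where open Presheaf P

  _×ᴾ_ : Presheaf → Presheaf → Presheaf
  P ×ᴾ Q = record
    { F₀   = λ X → P.F₀ X × Q.F₀ X
    ; _·_  = λ { (p , q) f → (p P.· f , q Q.· f) }
    ; ·-id = λ { (p , q) → cong₂ _,_ (P.·-id p) (Q.·-id q) }
    ; ·-∘  = λ { (p , q) f g → cong₂ _,_ (P.·-∘ p f g) (Q.·-∘ q f g) }
    }
    where
      module P = Presheaf P
      module Q = Presheaf Q

  Sim : (R : Presheaf) {X : Obj} → Presheaf.F₀ R X → Presheaf.F₀ R X → Set
  Sim R {X} r r' = Σ[ Z ∈ Obj ] Σ[ u ∈ Hom Z X ] Σ[ u' ∈ Hom Z X ] (r · u ≡ r' · u')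
    where open Presheaf R

-- Write x · u ≡ x' · u' with u, u' : Z → X and complete the cospan u', u to a
-- commuting square u' ∘ a ≡ u ∘ s. Restricting along p := u', the pair
-- (x · u', y · u') is then identified with (x' · u', y · u) by the span a, s:
-- the first components through x · u ≡ x' · u', the second because the square
-- commutes.
module Submission where

open import Defs
open import Data.Product using (Σ; Σ-syntax; _×_; _,_)
open import Relation.Binary.PropositionalEquality
  using (_≡_; cong; cong₂; sym; module ≡-Reasoning)

module _ {C : Category} where
  open Category C

  module _ (R : Presheaf C) where
    open Presheaf R

    ·-square : ∀ {X Y Z W} (r : F₀ X) {f : Hom Y X} {g : Hom Z X}
               {u : Hom W Y} {v : Hom W Z} →
               f ∘ u ≡ g ∘ v → r · f · u ≡ r · g · v
    ·-square r {f} {g} {u} {v} sq = begin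
      r · f · u    ≡⟨ sym (·-∘ r f u) ⟩
      r · (f ∘ u)  ≡⟨ cong (r ·_) sq ⟩
      r · (g ∘ v)  ≡⟨ ·-∘ r g v ⟩
      r · g · v    ∎
      where open ≡-Reasoning

  Sim-×ᴾ : (P Q : Presheaf C) {X Z : Obj} {p p' : Presheaf.F₀ P X}
           {q q' : Presheaf.F₀ Q X} (u u' : Hom Z X) →
           Presheaf._·_ P p u ≡ Presheaf._·_ P p' u' →
           Presheaf._·_ Q q u ≡ Presheaf._·_ Q q' u' →
           Sim C (_×ᴾ_ C P Q) (p , q) (p' , q')
  Sim-×ᴾ P Q {Z = Z} u u' eqP eqQ = Z , u , u' , cong₂ _,_ eqP eqQ

lemma5p4 : (C : Category) → Coconfluent C →
    (P Q : Presheaf C) → IsAtomic C P → IsAtomic C Q →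
    ∀ {X : Category.Obj C} (x x' : Presheaf.F₀ P X) → Sim C P x x' →
    (y : Presheaf.F₀ Q X) →
    Σ[ Z ∈ Category.Obj C ] Σ[ p ∈ Category.Hom C Z X ] Σ[ y' ∈ Presheaf.F₀ Q Z ]
    Sim C (_×ᴾ_ C P Q) {Z}
    (Presheaf._·_ P x p , Presheaf._·_ Q y p)
    (Presheaf._·_ P x' p , y')
lemma5p4 C coconfluent P Q _ _ x x' (Z , u , u' , x·u≡x'·u') y
  with coconfluent u' u
... | _ , a , s , square = Z , u' , y Q.· u , Sim-×ᴾ P Q a s first second
  where
    module P = Presheaf P
    module Q = Presheaf Q
    open ≡-Reasoning

    first : x P.· u' P.· a ≡ x' P.· u' P.· s
    first = begin
      x P.· u' P.· a   ≡⟨ ·-square P x square ⟩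
      x P.· u P.· s    ≡⟨ cong (P._· s) x·u≡x'·u' ⟩
      x' P.· u' P.· s  ∎

    second : y Q.· u' Q.· a ≡ y Q.· u Q.· s
    second = ·-square Q y square
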